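{- $\vdash_{\mathrm{S4}}\neg\Box\sigma$, where $\sigma:=\langle T\le\mathrm{Fr}\rangle\wedge\bigwedge_{d\in D}(\langle T=d\rangle\to\sigma_d)$ and $\sigma_d:=\langle T=d\rangle\wedge\neg\Box\langle T\le d\rangle$.
   Context: Modal formulas are built from variables $X_1,\dots,X_5$ and $\bot$ using $\to$ and $\Box$ (usual derived connectives; $\Diamond\varphi:=\neg\Box\neg\varphi$). Kripke models $\mathcal{M}=(W,E,V)$ with truth defined as usual ($\Box\varphi$ holds at $w$ iff $\varphi$ holds at all $E$-successors of $w$). Throughout, the axiom $(\mathrm{Ax}_{\le1})=\bigwedge_{1\le i<j\le5}(\neg X_i\vee\neg X_j)$ is tacitly assumed. $\vdash_{\mathrm{S4}}\varphi$ means $\varphi$ is provable in modal system S4 (system K plus all instances of $\Box\varphi\to\varphi$ and $\Box\varphi\to\Box\Box\varphi$) with $(\mathrm{Ax}_{\le1})$ as additional axiom; equivalently, $\varphi$ holds in every world of every Kripke model with reflexive and transitive $E$ in which $(\mathrm{Ax}_{\le1})$ holds at every world. Let $R=\{\mathrm{Mo},\mathrm{Tu},\mathrm{We},\mathrm{Th},\mathrm{Fr},\mathrm{none}\}$ with $\mathrm{Mo}<\dots<\mathrm{Fr}<\mathrm{none}$, $D=\{\mathrm{Mo},\dots,\mathrm{Fr}\}$; $Y_{\mathrm{Mo}}=X_1,\dots,Y_{\mathrm{Fr}}=X_5$, $Y_{\mathrm{none}}=\neg(X_1\vee\dots\vee X_5)$. For $B\subseteq R$: $\langle T\in B\rangle:=\bigvee_{r\in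 B}Y_r$, $\langle T=r\rangle:=Y_r$, $\langle T\le d\rangle:=\langle T\in\{r\in R:r\le d\}\rangle$. -}

module Defs where

open import Data.Fin using (Fin; zero; suc)
open import Data.Bool using (Bool; true; false; T)
open import Data.List using (List; []; _∷_; foldr)
open import Data.Empty using (⊥)
open import Relation.Binary.Core using (Rel)
open import Relation.Binary.Definitions using (Reflexive; Transitive)

data Fm : Set where
  var  : Fin 5 → Fm
  bot  : Fm
  _⇒_  : Fm → Fm → Fm
  □_   : Fm → Fm

infixr 5 _⇒_
infix  8 □_

¬f_ : Fm → Fm
¬f φ = φ ⇒ bot

_∨f_ : Fm → Fm → Fm
φ ∨f ψ = (¬f φ) ⇒ ψ

_∧f_ : Fm → Fm → Fm
φ ∧f ψ = ¬f (φ ⇒ ¬f ψ)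

⊤f : Fm
⊤f = ¬f bot

◇_ : Fm → Fm
◇ φ = ¬f (□ (¬f φ))

infixr 6 _∧f_
infixr 6 _∨f_
infix  9 ¬f_

⋁ : List Fm → Fm
⋁ = foldr _∨f_ bot

⋀ : List Fm → Fm
⋀ = foldr _∧f_ ⊤f

record Model : Set₁ where
  field
    W : Set
    E : Rel W _
    V : W → Fin 5 → Bool

module _ (M : Model) where
  open Model M
  _⊨_ : W → Fm → Set
  w ⊨ var i  = T (V w i)
  w ⊨ bot    = ⊥
  w ⊨ (φ ⇒ ψ) = w ⊨ φ → w ⊨ ψ
  w ⊨ (□ φ)  = ∀ v → E w v → v ⊨ φ

X₁ X₂ X₃ X₄ X₅ : Fm
X₁ = var zero
X₂ = var (suc zero)
X₃ = var (suc (suc zero))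
X₄ = var (suc (suc (suc zero)))
X₅ = var (suc (suc (suc (suc zero))))

Ax≤1 : Fm
Ax≤1 = ⋀ ( (¬f X₁ ∨f ¬f X₂) ∷ (¬f X₁ ∨f ¬f X₃) ∷ (¬f X₁ ∨f ¬f X₄) ∷ (¬f X₁ ∨f ¬f X₅)
         ∷ (¬f X₂ ∨f ¬f X₃) ∷ (¬f X₂ ∨f ¬f X₄) ∷ (¬f X₂ ∨f ¬f X₅)
         ∷ (¬f X₃ ∨f ¬f X₄) ∷ (¬f X₃ ∨f ¬f X₅)
         ∷ (¬f X₄ ∨f ¬f X₅) ∷ [])

⊢S4_ : Fm → Set₁
⊢S4 φ = (M : Model) → Reflexive (Model.E M) → Transitive (Model.E M)
      → (∀ w → _⊨_ M w Ax≤1) → ∀ w → _⊨_ M w φ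

data Rv : Set where
  Mo Tu We Th Fr none : Rv

Dlist : List Rv
Dlist = Mo ∷ Tu ∷ We ∷ Th ∷ Fr ∷ []

≤list : Rv → List Rv
≤list Mo   = Mo ∷ []
≤list Tu   = Mo ∷ Tu ∷ []
≤list We   = Mo ∷ Tu ∷ We ∷ []
≤list Th   = Mo ∷ Tu ∷ We ∷ Th ∷ []
≤list Fr   = Mo ∷ Tu ∷ We ∷ Th ∷ Fr ∷ []
≤list none = Mo ∷ Tu ∷ We ∷ Th ∷ Fr ∷ none ∷ []

Y : Rv → Fm
Y Mo   = X₁
Y Tu   = X₂
Y We   = X₃
Y Th   = X₄
Y Fr   = X₅
Y none = ¬f (⋁ (X₁ ∷ X₂ ∷ X₃ ∷ X₄ ∷ X₅ ∷ []))

⟨T∈_⟩ : List Rv → Fm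
⟨T∈ B ⟩ = ⋁ (Data.List.map Y B)

⟨T=_⟩ : Rv → Fm
⟨T= r ⟩ = Y r

⟨T≤_⟩ : Rv → Fm
⟨T≤ d ⟩ = ⟨T∈ ≤list d ⟩

σ_ : Rv → Fm
σ d = ⟨T= d ⟩ ∧f ¬f (□ ⟨T≤ d ⟩)

σ : Fm
σ = ⟨T≤ Fr ⟩ ∧f ⋀ (Data.List.map (λ d → ⟨T= d ⟩ ⇒ σ_ d) Dlist)

{-# OPTIONS --safe #-}
-- If □σ held at w, then σ would hold at
-- every world reachable from w.  By backward induction on the day d, no such
-- world u has the exam on d: σ_d at u yields a reachable world v with the exam
-- after d, yet at v the exam is on no later day (induction hypothesis) while σ
-- at v puts it on some day.  At w itself the exam is then on no day at all,
-- contradicting ⟨T≤Fr⟩.  Forcing is ¬¬-stable, so the classically encoded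
-- connectives can be eliminated constructively.
module Submission where

open import Defs
open import Data.Product using (_×_; _,_; proj₁; proj₂)
open import Data.List using (List; []; _∷_; _++_; map)
open import Data.List.Membership.Propositional using (_∈_)
open import Data.List.Relation.Unary.Any using (here; there)
open import Data.List.Relation.Unary.All as All using (All; []; _∷_)
open import Data.List.Relation.Unary.All.Properties using (map⁺; map⁻; ++⁺)
open import Relation.Binary.Definitions using (Reflexive; Transitive)
open import Relation.Binary.PropositionalEquality using (_≡_; refl; subst)
open import Relation.Nullary.Negation using (¬_; Stable)
open import Relation.Nullary.Decidable using (T?; decidable-stable)

module Semantics (M : Model) where
  open Model M

  infix 4 _⊩_
  _⊩_ : W → Fm → Set
  w ⊩ φ = _⊨_ M w φ

  ⊩-stable : ∀ w φ → Stable (w ⊩ φ)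
  ⊩-stable w (var i) = decidable-stable (T? (V w i))
  ⊩-stable w bot     ¬¬⊥ = ¬¬⊥ (λ ())
  ⊩-stable w (φ ⇒ ψ) ¬¬φ⇒ψ a = ⊩-stable w ψ (λ ¬b → ¬¬φ⇒ψ (λ f → ¬b (f a)))
  ⊩-stable w (□ φ)   ¬¬□φ v e = ⊩-stable v φ (λ ¬a → ¬¬□φ (λ h → ¬a (h v e)))

  ⊩∧-elim : ∀ {w} φ ψ → w ⊩ φ ∧f ψ → w ⊩ φ × w ⊩ ψ
  ⊩∧-elim {w} φ ψ φ∧ψ =
      ⊩-stable w φ (λ ¬a → φ∧ψ (λ a _ → ¬a a))
    , ⊩-stable w ψ (λ ¬b → φ∧ψ (λ _ b → ¬b b))

  ⊩⋀-elim : ∀ {w} φs → w ⊩ ⋀ φs → All (w ⊩_) φs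
  ⊩⋀-elim []       _    = []
  ⊩⋀-elim (φ ∷ φs) ⋀φφs = let a , as = ⊩∧-elim φ (⋀ φs) ⋀φφs in a ∷ ⊩⋀-elim φs as

  ⊩⋁-intro : ∀ {w} φs → ¬ All (λ φ → ¬ w ⊩ φ) φs → w ⊩ ⋁ φs
  ⊩⋁-intro []       ¬refuted    = ¬refuted []
  ⊩⋁-intro (φ ∷ φs) ¬refuted ¬a = ⊩⋁-intro φs (λ refuted → ¬refuted (¬a ∷ refuted))

  ⊩⋁-elim : ∀ {w} φs → w ⊩ ⋁ φs → ¬ All (λ φ → ¬ w ⊩ φ) φs
  ⊩⋁-elim []       ⊩⊥   []             = ⊩⊥
  ⊩⋁-elim (φ ∷ φs) ⋁φφs (¬a ∷ refuted) = ⊩⋁-elim φs (⋁φφs ¬a) refuted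

  ⊩⟨T∈⟩-intro : ∀ {w} B → ¬ All (λ r → ¬ w ⊩ ⟨T= r ⟩) B → w ⊩ ⟨T∈ B ⟩
  ⊩⟨T∈⟩-intro B ¬refuted = ⊩⋁-intro (map Y B) (λ refuted → ¬refuted (map⁻ refuted))

  ⊩⟨T∈⟩-elim : ∀ {w} B → w ⊩ ⟨T∈ B ⟩ → ¬ All (λ r → ¬ w ⊩ ⟨T= r ⟩) B
  ⊩⟨T∈⟩-elim B T∈B refuted = ⊩⋁-elim (map Y B) T∈B (map⁺ refuted)

  □-elim : Reflexive E → ∀ {w} φ → w ⊩ □ φ → w ⊩ φ
  □-elim E-refl {w} _ □φ = □φ w E-refl

  □-step : Transitive E → ∀ {u v} φ → u ⊩ □ φ → E u v → v ⊩ □ φ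
  □-step E-trans _ □φ u→v v′ v→v′ = □φ v′ (E-trans u→v v→v′)

later : Rv → List Rv
later Mo   = Tu ∷ We ∷ Th ∷ Fr ∷ []
later Tu   = We ∷ Th ∷ Fr ∷ []
later We   = Th ∷ Fr ∷ []
later Th   = Fr ∷ []
later Fr   = []
later none = []

≤list-++-later : ∀ {d} → d ∈ Dlist → ≤list d ++ later d ≡ ≤list Fr
≤list-++-later (here refl)                                 = refl
≤list-++-later (there (here refl))                         = refl
≤list-++-later (there (there (here refl)))                 = refl
≤list-++-later (there (there (there (here refl))))         = refl
≤list-++-later (there (there (there (there (here refl))))) = refl

module SurpriseExam (M : Model) (E-refl : Reflexive (Model.E M)) (E-trans : Transitive (Model.E M)) where
  open Semantics M

  surprise-rule : Rv → Fm
  surprise-rule d = ⟨T= d ⟩ ⇒ σ_ d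

  σ-elim : ∀ {u} → u ⊩ σ → u ⊩ ⟨T≤ Fr ⟩ × All (λ d → u ⊩ surprise-rule d) Dlist
  σ-elim {u} σu =
    let T≤Fr , rules = ⊩∧-elim {u} ⟨T≤ Fr ⟩ (⋀ (map surprise-rule Dlist)) σu
    in  T≤Fr , map⁻ {f = surprise-rule} (⊩⋀-elim {u} (map surprise-rule Dlist) rules)

  σ⇒⟨T≤Fr⟩ : ∀ {u} → u ⊩ σ → u ⊩ ⟨T≤ Fr ⟩
  σ⇒⟨T≤Fr⟩ σu = proj₁ (σ-elim σu)

  σ⇒surprise : ∀ {u d} → u ⊩ σ → d ∈ Dlist → u ⊩ ⟨T= d ⟩ → u ⊩ ¬f (□ ⟨T≤ d ⟩)
  σ⇒surprise {u} {d} σu d∈D exam =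
    proj₂ (⊩∧-elim {u} ⟨T= d ⟩ (¬f (□ ⟨T≤ d ⟩)) (All.lookup (proj₂ (σ-elim σu)) d∈D exam))

  ⟨T≤Fr⟩⇒⟨T≤⟩ : ∀ {v d} → d ∈ Dlist → v ⊩ ⟨T≤ Fr ⟩
              → All (λ r → ¬ v ⊩ ⟨T= r ⟩) (later d) → v ⊩ ⟨T≤ d ⟩
  ⟨T≤Fr⟩⇒⟨T≤⟩ {v} {d} d∈D T≤Fr refutedLater = ⊩⟨T∈⟩-intro (≤list d) λ refutedUpTo →
    ⊩⟨T∈⟩-elim (≤list Fr) T≤Fr
      (subst (All (λ r → ¬ v ⊩ ⟨T= r ⟩)) (≤list-++-later d∈D) (++⁺ refutedUpTo refutedLater))

  NoExamOn : Rv → Set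
  NoExamOn d = ∀ {u} → u ⊩ □ σ → ¬ u ⊩ ⟨T= d ⟩

  no-exam-on : ∀ {d} → d ∈ Dlist → All NoExamOn (later d) → NoExamOn d
  no-exam-on d∈D noExamLater □σ exam =
    σ⇒surprise (□-elim E-refl σ □σ) d∈D exam λ v u→v →
      let □σv = □-step E-trans σ □σ u→v in
      ⟨T≤Fr⟩⇒⟨T≤⟩ d∈D (σ⇒⟨T≤Fr⟩ (□-elim E-refl σ □σv))
        (All.map (λ noExam → noExam □σv) noExamLater)

  no-exam-on-any-day : All NoExamOn Dlist
  no-exam-on-any-day = mo ∷ tu ∷ we ∷ th ∷ fr ∷ []
    where
    mo : NoExamOn Mo
    tu : NoExamOn Tu
    we : NoExamOn We
    th : NoExamOn Th
    fr : NoExamOn Fr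
    fr = no-exam-on (there (there (there (there (here refl))))) []
    th = no-exam-on (there (there (there (here refl)))) (fr ∷ [])
    we = no-exam-on (there (there (here refl))) (th ∷ fr ∷ [])
    tu = no-exam-on (there (here refl)) (we ∷ th ∷ fr ∷ [])
    mo = no-exam-on (here refl) (tu ∷ we ∷ th ∷ fr ∷ [])

theorem6p16 : ⊢S4 (¬f (□ σ))
theorem6p16 M E-refl E-trans _ w □σ =
  ⊩⟨T∈⟩-elim (≤list Fr) (σ⇒⟨T≤Fr⟩ (□-elim E-refl σ □σ))
    (All.map (λ noExam → noExam □σ) no-exam-on-any-day)
  where
  open Semantics M
  open SurpriseExam M E-refl E-trans
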